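{- For any $p\in\mathrm{OFS}(\mathbb{Z}^+)$ the following hold. (i) $f(p)\ge fw(p)$. (ii) If $|p|\ge 2$ and $i$ is an index with $1\le i<|p|$ such that $\gcd(p)=\gcd(p|_j)$ for all $j$ with $i\le j<|p|$ and $p_{i+1}\ge f(p|_i)$, then $f(p|_j)=p_j$ for all $j$ with $i+1\le j\le |p|$.
   Context: $\mathrm{OFS}(\mathbb{Z}^+)$ denotes the set of all nonempty strictly increasing finite sequences of positive integers. For $p\in\mathrm{OFS}(\mathbb{Z}^+)$, $|p|$ is its length, $p_i$ its $i$-th entry, $p|_i=(p_1,\ldots,p_i)$, $\gcd(p)$ the gcd of its entries, $\max(p)=p_{|p|}$. The map $R$: $R(p)=p$ if $|p|=1$; if $n=|p|>1$, form $(p_2-p_1,\ldots,p_n-p_1)$ and, if $p_1$ does not appear in it, insert $p_1$ so that the result is strictly increasing. $f$ is defined recursively by $f(p)=p_1$ if $|p|=1$ and $f(p)=p_1+f(R(p))$ if $|p|>1$. $fw$ is defined by: if $n=|p|>1$, $\gcd(p|_{n-1})=\gcd(p)$ and $\max(p)\ge f(p|_{n-1})$, then $fw(p)=fw(p|_{n-1})$; otherwise $fw(p)=f(p)$. -}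

module Defs where

open import Data.Nat using (ℕ; zero; suc; _+_; _∸_; _<_; _≤_; _≤ᵇ_; _≡ᵇ_; _<ᵇ_)
open import Data.Nat.GCD using (gcd)
open import Data.Bool using (Bool; true; false; if_then_else_; _∧_)
open import Data.List using (List; []; _∷_; map; foldr; length; take)
open import Data.Nat.ListAction using (sum)
open import Data.List.Relation.Unary.All using (All)
open import Data.List.Relation.Unary.Linked using (Linked)
open import Data.Product using (_×_)

data NonEmptyL {A : Set} : List A → Set where
  nonempty : ∀ {x xs} → NonEmptyL (x ∷ xs)

IsOFS : List ℕ → Set
IsOFS p = NonEmptyL p × All (λ x → 0 < x) p × Linked _<_ p

-- 1-based entry p_i (default 0 outside range; only used in range)
entry : List ℕ → ℕ → ℕ
entry []       _             = 0
entry (x ∷ xs) zero          = 0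
entry (x ∷ xs) (suc zero)    = x
entry (x ∷ xs) (suc (suc i)) = entry xs (suc i)

-- max(p) = last entry p_{|p|}
lastL : List ℕ → ℕ
lastL []           = 0
lastL (x ∷ [])     = x
lastL (x ∷ y ∷ ys) = lastL (y ∷ ys)

gcdL : List ℕ → ℕ
gcdL = foldr gcd 0

prefix : List ℕ → ℕ → List ℕ
prefix p i = take i p

insertIfAbsent : ℕ → List ℕ → List ℕ
insertIfAbsent x []       = x ∷ []
insertIfAbsent x (y ∷ ys) =
  if x <ᵇ y then x ∷ y ∷ ys
  else if x ≡ᵇ y then y ∷ ys
  else y ∷ insertIfAbsent x ys

R : List ℕ → List ℕ
R []           = []
R (x ∷ [])     = x ∷ []
R (x ∷ y ∷ ys) = insertIfAbsent x (map (λ z → z ∸ x) (y ∷ ys))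

-- f with fuel; for p ∈ OFS, max strictly decreases under R when |p|>1,
-- so fuel sum p (≥ max p) suffices.
fFuel : ℕ → List ℕ → ℕ
fFuel _       []           = 0
fFuel _       (x ∷ [])     = x
fFuel zero    (x ∷ y ∷ ys) = 0
fFuel (suc k) (x ∷ y ∷ ys) = x + fFuel k (R (x ∷ y ∷ ys))

f : List ℕ → ℕ
f p = fFuel (sum p) p

-- fw with fuel (length decreases by one each step; fuel |p| suffices)
fwFuel : ℕ → List ℕ → ℕ
fwFuel zero    p = f p
fwFuel (suc k) p =
  let n  = length p
      q  = prefix p (n ∸ 1)
  in if (2 ≤ᵇ n) ∧ (gcdL q ≡ᵇ gcdL p) ∧ (f q ≤ᵇ lastL p)
     then fwFuel k q
     else f p

fw : List ℕ → ℕ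
fw p = fwFuel (length p) p

module Submission where

-- Write  max q  for the last entry of an increasing list q.
-- The heart of the argument is the EXTENSION LEMMA (f-append): if q is an
-- OFS, x > max q, gcd(q) ∣ x and f(q) ≤ x, then f(q ++ [x]) = x.  With a = q₁ and y = x − a we have
-- R(q ++ [x]) = ins a (map (_∸ a) q₂… ++ [y]), and a ≤ f(R q) ≤ y.  If a < y
-- then R(q ++ [x]) = R q ++ [y] and the induction hypothesis applies to
-- (R q, y); if a = y the new entry is absorbed, R(q ++ [x]) = R q, and
-- f(R q) = y is forced by the sandwich a ≤ f(R q) ≤ y.
--
-- Part (ii) of the theorem follows by applying the
-- extension lemma prefix after prefix; part (i) by unfolding fw, since each
-- step of fw passes to a prefix q of p with f q ≤ max p ≤ f p.

open import Defs
open import Data.Nat using (ℕ; zero; suc; _+_; _∸_; _⊔_; _≤_; _<_; z≤n; s≤s; _≤ᵇ_; _≡ᵇ_; >-nonZero)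
open import Data.Nat.Properties
open import Data.Nat.Divisibility using (_∣_; ∣-refl; ∣-trans; _∣0; ∣⇒≤; ∣m+n∣m⇒∣n; ∣m∸n∣n⇒∣m)
open import Data.Nat.GCD using (gcd[m,n]∣m; gcd[m,n]∣n; gcd-greatest)
open import Data.Nat.ListAction using (sum)
open import Data.List using (List; []; _∷_; _++_; map; take; length)
open import Data.List.Properties using (map-++)
open import Data.List.Relation.Unary.All using (All; []; _∷_)
open import Data.List.Relation.Unary.All.Properties using (take⁺; ++⁺; map⁺)
import Data.List.Relation.Unary.All as All
open import Data.List.Relation.Unary.Linked using (Linked; []; [-]; _∷_)
open import Data.List.Relation.Unary.Linked.Properties using (Linked⇒All)
open import Data.Product using (_×_; _,_; proj₁; proj₂)
open import Data.Sum using (inj₁; inj₂)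
open import Data.Bool using (true; false; T)
open import Data.Unit using (tt)
open import Data.Empty using (⊥; ⊥-elim)
open import Relation.Binary.PropositionalEquality
  using (_≡_; refl; sym; trans; cong; subst; module ≡-Reasoning)
open import Relation.Binary.Definitions using (tri<; tri≈; tri>)

above-head : ∀ {a t} → Linked _<_ (a ∷ t) → All (a <_) t
above-head [-]       = []
above-head (a<b ∷ L) = Linked⇒All <-trans a<b L

head≤lastL : ∀ {a t} → Linked _<_ (a ∷ t) → a ≤ lastL (a ∷ t)
head≤lastL [-]       = ≤-refl
head≤lastL (a<b ∷ L) = ≤-trans (<⇒≤ a<b) (head≤lastL L)

below-bound : ∀ {q x} → Linked _<_ q → lastL q < x → All (_< x) q
below-bound []        _  = []
below-bound [-]       lt = lt ∷ []
below-bound (a<b ∷ L) lt with below-bound L lt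
... | b<x ∷ rest = <-trans a<b b<x ∷ b<x ∷ rest

snoc-linked : ∀ {q x} → Linked _<_ q → lastL q < x → Linked _<_ (q ++ x ∷ [])
snoc-linked []        _  = [-]
snoc-linked [-]       lt = lt ∷ [-]
snoc-linked (a<b ∷ L) lt = a<b ∷ snoc-linked L lt

lastL-cons : ∀ y {l} → NonEmptyL l → lastL (y ∷ l) ≡ lastL l
lastL-cons y nonempty = refl

lastL-map∸ : ∀ a l → lastL (map (_∸ a) l) ≡ lastL l ∸ a
lastL-map∸ a []           = sym (0∸n≡0 a)
lastL-map∸ a (y ∷ [])     = refl
lastL-map∸ a (y ∷ z ∷ zs) = lastL-map∸ a (z ∷ zs)

All-entry : ∀ {P : ℕ → Set} {p} → P 0 → All P p → ∀ j → P (entry p j)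
All-entry P0 []       j             = P0
All-entry P0 (_ ∷ _)  zero          = P0
All-entry P0 (px ∷ _) (suc zero)    = px
All-entry P0 (_ ∷ ps) (suc (suc j)) = All-entry P0 ps (suc j)

gcdL-divides : ∀ l → All (gcdL l ∣_) l
gcdL-divides []       = []
gcdL-divides (x ∷ xs) =
  gcd[m,n]∣m x (gcdL xs) ∷ All.map (∣-trans (gcd[m,n]∣n x (gcdL xs))) (gcdL-divides xs)

∣gcdL : ∀ {d} l → All (d ∣_) l → d ∣ gcdL l
∣gcdL []       []       = _ ∣0
∣gcdL (x ∷ xs) (h ∷ hs) = gcd-greatest h (∣gcdL xs hs)

∣∸ : ∀ {d m n} → n ≤ m → d ∣ m → d ∣ n → d ∣ m ∸ n
∣∸ n≤m d∣m d∣n = ∣m+n∣m⇒∣n (subst (_ ∣_) (sym (m+[n∸m]≡n n≤m)) d∣m) d∣n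

≤∸ : ∀ a {u x} → a + u ≤ x → u ≤ x ∸ a
≤∸ a {u} h = subst (_≤ _ ∸ a) (m+n∸m≡n a u) (∸-monoˡ-≤ a h)

ins : ℕ → List ℕ → List ℕ
ins = insertIfAbsent

T⇒≡true : ∀ {b} → T b → b ≡ true
T⇒≡true {true} _ = refl

¬T⇒≡false : ∀ {b} → (T b → ⊥) → b ≡ false
¬T⇒≡false {true}  h = ⊥-elim (h _)
¬T⇒≡false {false} _ = refl

ins-lt : ∀ a y ys → a < y → ins a (y ∷ ys) ≡ a ∷ y ∷ ys
ins-lt a y ys a<y rewrite T⇒≡true (<⇒<ᵇ a<y) = refl

ins-eq : ∀ a ys → ins a (a ∷ ys) ≡ a ∷ ys
ins-eq a ys rewrite ¬T⇒≡false (λ t → <-irrefl refl (<ᵇ⇒< a a t))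
                  | T⇒≡true (≡⇒≡ᵇ a a refl) = refl

ins-gt : ∀ a y ys → y < a → ins a (y ∷ ys) ≡ y ∷ ins a ys
ins-gt a y ys y<a rewrite ¬T⇒≡false (λ t → <-asym (<ᵇ⇒< a y t) y<a)
                        | ¬T⇒≡false (λ t → <-irrefl (sym (≡ᵇ⇒≡ a y t)) y<a) = refl

ins-nonempty : ∀ a l → NonEmptyL (ins a l)
ins-nonempty a []       = nonempty
ins-nonempty a (y ∷ ys) with <-cmp a y
... | tri< a<y _ _    rewrite ins-lt a y ys a<y = nonempty
... | tri≈ _ refl _   rewrite ins-eq a ys       = nonempty
... | tri> _ _ y<a    rewrite ins-gt a y ys y<a = nonempty

ins-All⁺ : ∀ {P : ℕ → Set} a l → P a → All P l → All P (ins a l)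
ins-All⁺ a []       pa []         = pa ∷ []
ins-All⁺ a (y ∷ ys) pa (py ∷ pys) with <-cmp a y
... | tri< a<y _ _  rewrite ins-lt a y ys a<y = pa ∷ py ∷ pys
... | tri≈ _ refl _ rewrite ins-eq a ys       = py ∷ pys
... | tri> _ _ y<a  rewrite ins-gt a y ys y<a = py ∷ ins-All⁺ a ys pa pys

ins-All⁻ : ∀ {P : ℕ → Set} a l → All P (ins a l) → P a × All P l
ins-All⁻ a []       (pa ∷ []) = pa , []
ins-All⁻ a (y ∷ ys) h with <-cmp a y
... | tri< a<y _ _  rewrite ins-lt a y ys a<y with h
...   | pa ∷ rest = pa , rest
ins-All⁻ a (y ∷ ys) h | tri≈ _ refl _ rewrite ins-eq a ys with h
...   | pa ∷ rest = pa , pa ∷ rest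
ins-All⁻ a (y ∷ ys) h | tri> _ _ y<a  rewrite ins-gt a y ys y<a with h
...   | py ∷ rest with ins-All⁻ a ys rest
...     | pa , pys = pa , py ∷ pys

cons-linked : ∀ {y l} → All (y <_) l → Linked _<_ l → Linked _<_ (y ∷ l)
cons-linked []      []  = [-]
cons-linked (h ∷ _) L   = h ∷ L

linked-tail : ∀ {y l} → Linked _<_ (y ∷ l) → Linked _<_ l
linked-tail [-]     = []
linked-tail (_ ∷ L) = L

ins-linked : ∀ a {l} → Linked _<_ l → Linked _<_ (ins a l)
ins-linked a {[]}     _ = [-]
ins-linked a {y ∷ ys} L with <-cmp a y
... | tri< a<y _ _  rewrite ins-lt a y ys a<y = a<y ∷ L
... | tri≈ _ refl _ rewrite ins-eq a ys       = L
... | tri> _ _ y<a  rewrite ins-gt a y ys y<a =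
  cons-linked (ins-All⁺ a ys y<a (above-head L)) (ins-linked a (linked-tail L))

lastL-ins : ∀ a {l} → Linked _<_ l → lastL (ins a l) ≡ a ⊔ lastL l
lastL-ins a {[]}     _ = sym (⊔-identityʳ a)
lastL-ins a {y ∷ ys} L with <-cmp a y
... | tri< a<y _ _  rewrite ins-lt a y ys a<y =
  sym (m≤n⇒m⊔n≡n (≤-trans (<⇒≤ a<y) (head≤lastL L)))
... | tri≈ _ refl _ rewrite ins-eq a ys = sym (m≤n⇒m⊔n≡n (head≤lastL L))
... | tri> _ _ y<a  rewrite ins-gt a y ys y<a = above y<a L
  where
  above : ∀ {y ys} → y < a → Linked _<_ (y ∷ ys) → lastL (y ∷ ins a ys) ≡ a ⊔ lastL (y ∷ ys)
  above {y} {[]}     y<a _ = sym (m≥n⇒m⊔n≡m (<⇒≤ y<a))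
  above {y} {z ∷ zs} y<a L =
    trans (lastL-cons y (ins-nonempty a (z ∷ zs))) (lastL-ins a (linked-tail L))

ins-snoc-below : ∀ a y l → a < y → ins a (l ++ y ∷ []) ≡ ins a l ++ y ∷ []
ins-snoc-below a y []       a<y = ins-lt a y [] a<y
ins-snoc-below a y (z ∷ zs) a<y with <-cmp a z
... | tri< a<z _ _  rewrite ins-lt a z (zs ++ y ∷ []) a<z | ins-lt a z zs a<z = refl
... | tri≈ _ refl _ rewrite ins-eq a (zs ++ y ∷ []) | ins-eq a zs = refl
... | tri> _ _ z<a  rewrite ins-gt a z (zs ++ y ∷ []) z<a | ins-gt a z zs z<a =
  cong (z ∷_) (ins-snoc-below a y zs a<y)

ins-snoc-absorb : ∀ a l → All (_< a) l → ins a (l ++ a ∷ []) ≡ ins a l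
ins-snoc-absorb a []       []          = ins-eq a []
ins-snoc-absorb a (z ∷ zs) (z<a ∷ lts)
  rewrite ins-gt a z (zs ++ a ∷ []) z<a | ins-gt a z zs z<a =
  cong (z ∷_) (ins-snoc-absorb a zs lts)

-- R subtracts the head from the tail and reinserts the head; for a
-- singleton this reading is also correct.
R-cons : ∀ a t → R (a ∷ t) ≡ ins a (map (_∸ a) t)
R-cons a []      = refl
R-cons a (_ ∷ _) = refl

R-snoc : ∀ a t x → R (a ∷ t ++ x ∷ []) ≡ ins a (map (_∸ a) t ++ x ∸ a ∷ [])
R-snoc a t x = trans (R-cons a (t ++ x ∷ [])) (cong (ins a) (map-++ (_∸ a) t (x ∷ [])))

map∸-linked : ∀ {a t} → Linked _<_ (a ∷ t) → Linked _<_ (map (_∸ a) t)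
map∸-linked [-]                 = []
map∸-linked (a<b ∷ [-])         = [-]
map∸-linked (a<b ∷ (b<c ∷ L))   =
  ∸-monoˡ-< b<c (<⇒≤ a<b) ∷ map∸-linked (<-trans a<b b<c ∷ L)

OFS-R : ∀ {q} → IsOFS q → IsOFS (R q)
OFS-R {a ∷ t} (_ , (0<a ∷ _) , L) rewrite R-cons a t =
  ins-nonempty a (map (_∸ a) t) ,
  ins-All⁺ a (map (_∸ a) t) 0<a (map⁺ (All.map m<n⇒0<n∸m (above-head L))) ,
  ins-linked a (map∸-linked L)

-- max t − a = max (a ∷ t) − a, also when t is empty (both sides are 0).
lastL-tail∸head : ∀ a t → lastL t ∸ a ≡ lastL (a ∷ t) ∸ a
lastL-tail∸head a []      = trans (0∸n≡0 a) (sym (n∸n≡0 a))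
lastL-tail∸head a (_ ∷ _) = refl

lastL-R : ∀ {a t} → IsOFS (a ∷ t) → lastL (R (a ∷ t)) ≡ a ⊔ (lastL (a ∷ t) ∸ a)
lastL-R {a} {t} (_ , _ , L) = begin
  lastL (R (a ∷ t))                 ≡⟨ cong lastL (R-cons a t) ⟩
  lastL (ins a (map (_∸ a) t))      ≡⟨ lastL-ins a (map∸-linked L) ⟩
  a ⊔ lastL (map (_∸ a) t)          ≡⟨ cong (a ⊔_) (lastL-map∸ a t) ⟩
  a ⊔ (lastL t ∸ a)                 ≡⟨ cong (a ⊔_) (lastL-tail∸head a t) ⟩
  a ⊔ (lastL (a ∷ t) ∸ a)           ∎
  where open ≡-Reasoning

head<lastL : ∀ {a b t} → IsOFS (a ∷ b ∷ t) → a < lastL (a ∷ b ∷ t)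
head<lastL (_ , _ , (a<b ∷ L)) = <-≤-trans a<b (head≤lastL L)

-- ... so R strictly decreases the maximum: this makes the fuel in f adequate.
R-shrinks : ∀ {a b t} → IsOFS (a ∷ b ∷ t) → lastL (R (a ∷ b ∷ t)) < lastL (a ∷ b ∷ t)
R-shrinks O@(_ , (0<a ∷ _) , _) rewrite lastL-R O =
  ⊔-lub (head<lastL O) (∸-monoʳ-< 0<a (<⇒≤ (head<lastL O)))

fFuel-irrelevant : ∀ {p} k k' → IsOFS p → lastL p ≤ k → lastL p ≤ k' → fFuel k p ≡ fFuel k' p
fFuel-irrelevant {_ ∷ []}    _       _        _ _ _   = refl
fFuel-irrelevant {_ ∷ _ ∷ _} zero    _        O h _   = ⊥-elim (<⇒≱ (head<lastL O) (≤-trans h z≤n))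
fFuel-irrelevant {_ ∷ _ ∷ _} (suc k) zero     O _ h'  = ⊥-elim (<⇒≱ (head<lastL O) (≤-trans h' z≤n))
fFuel-irrelevant {a ∷ b ∷ t} (suc k) (suc k') O h h' =
  cong (a +_) (fFuel-irrelevant k k' (OFS-R O) (shrink h) (shrink h'))
  where
  shrink : ∀ {n} → lastL (a ∷ b ∷ t) ≤ suc n → lastL (R (a ∷ b ∷ t)) ≤ n
  shrink h = ≤-pred (≤-trans (R-shrinks O) h)

-- sum p is enough fuel for f p.
lastL≤sum : ∀ l → lastL l ≤ sum l
lastL≤sum []           = z≤n
lastL≤sum (x ∷ [])     = m≤m+n x 0
lastL≤sum (x ∷ y ∷ ys) = ≤-trans (lastL≤sum (y ∷ ys)) (m≤n+m _ x)

f-unfold : ∀ {a t} → IsOFS (a ∷ t) → NonEmptyL t → f (a ∷ t) ≡ a + f (R (a ∷ t))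
f-unfold {zero}   (_ , (() ∷ _) , _) nonempty
f-unfold {suc a'} {b ∷ t} O nonempty =
  cong (suc a' +_) (fFuel-irrelevant _ _ (OFS-R O) bound (lastL≤sum (R (suc a' ∷ b ∷ t))))
  where
  bound : lastL (R (suc a' ∷ b ∷ t)) ≤ a' + sum (b ∷ t)
  bound = ≤-pred (≤-trans (R-shrinks O) (lastL≤sum (suc a' ∷ b ∷ t)))

lastL≤f-bounded : ∀ n {p} → IsOFS p → lastL p ≤ n → lastL p ≤ f p
lastL≤f-bounded _       {_ ∷ []}    _ _ = ≤-refl
lastL≤f-bounded zero    {_ ∷ _ ∷ _} O h = ⊥-elim (<⇒≱ (head<lastL O) (≤-trans h z≤n))
lastL≤f-bounded (suc n) {a ∷ b ∷ t} O h = begin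
  lastL (a ∷ b ∷ t)                  ≤⟨ m≤n+m∸n _ a ⟩
  a + (lastL (a ∷ b ∷ t) ∸ a)        ≤⟨ +-monoʳ-≤ a (m≤n⊔m a _) ⟩
  a + (a ⊔ (lastL (a ∷ b ∷ t) ∸ a))  ≡⟨ cong (a +_) (sym (lastL-R O)) ⟩
  a + lastL (R (a ∷ b ∷ t))          ≤⟨ +-monoʳ-≤ a (lastL≤f-bounded n (OFS-R O) shrunk) ⟩
  a + f (R (a ∷ b ∷ t))              ≡⟨ sym (f-unfold O nonempty) ⟩
  f (a ∷ b ∷ t)                      ∎
  where
  open ≤-Reasoning
  shrunk : lastL (R (a ∷ b ∷ t)) ≤ n
  shrunk = ≤-pred (≤-trans (R-shrinks O) h)

lastL≤f : ∀ {p} → IsOFS p → lastL p ≤ f p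
lastL≤f O = lastL≤f-bounded _ O ≤-refl

snoc-nonempty : ∀ (t : List ℕ) x → NonEmptyL (t ++ x ∷ [])
snoc-nonempty []      x = nonempty
snoc-nonempty (_ ∷ _) x = nonempty

OFS-snoc : ∀ {q x} → IsOFS q → lastL q < x → IsOFS (q ++ x ∷ [])
OFS-snoc {_ ∷ _} (_ , P , L) lt = nonempty , ++⁺ P (≤-<-trans z≤n lt ∷ []) , snoc-linked L lt

-- Under the hypotheses of the extension lemma, f (R q) ≤ x − q₁: for |q| ≥ 2
-- by unfolding f q ≤ x, and for q = [a] because a divides x − a > 0.
f-R≤ : ∀ {a t x} → IsOFS (a ∷ t) → lastL (a ∷ t) < x → gcdL (a ∷ t) ∣ x →
       f (a ∷ t) ≤ x → f (R (a ∷ t)) ≤ x ∸ a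
f-R≤ {a} {[]} {x} _ a<x g∣x _ =
  ∣⇒≤ {{>-nonZero (m<n⇒0<n∸m a<x)}} (∣∸ (<⇒≤ a<x) a∣x ∣-refl)
  where
  a∣x : a ∣ x
  a∣x = ∣-trans (gcd-greatest ∣-refl (a ∣0)) g∣x
f-R≤ {a} {_ ∷ _} O _ _ fq≤x = ≤∸ a (subst (_≤ _) (f-unfold O nonempty) fq≤x)

head≤f-R : ∀ {a t} → IsOFS (a ∷ t) → a ≤ f (R (a ∷ t))
head≤f-R O = ≤-trans (subst (_ ≤_) (sym (lastL-R O)) (m≤m⊔n _ _)) (lastL≤f (OFS-R O))

∣-lift : ∀ {d a t} → d ∣ a → All (a <_) t → All (d ∣_) (map (_∸ a) t) → All (d ∣_) t
∣-lift d∣a []          []       = []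
∣-lift d∣a (a<z ∷ lts) (h ∷ hs) = ∣m∸n∣n⇒∣m _ (<⇒≤ a<z) h d∣a ∷ ∣-lift d∣a lts hs

gcd-R∣ : ∀ {a t x} → IsOFS (a ∷ t) → a ≤ x → gcdL (a ∷ t) ∣ x → gcdL (R (a ∷ t)) ∣ x ∸ a
gcd-R∣ {a} {t} (_ , _ , L) a≤x g∣x =
  ∣∸ a≤x (∣-trans (∣gcdL (a ∷ t) (d∣a ∷ ∣-lift d∣a (above-head L) d∣diffs)) g∣x) d∣a
  where
  divides-R : All (gcdL (R (a ∷ t)) ∣_) (ins a (map (_∸ a) t))
  divides-R = subst (All _) (R-cons a t) (gcdL-divides (R (a ∷ t)))
  d∣a : gcdL (R (a ∷ t)) ∣ a
  d∣a = proj₁ (ins-All⁻ a (map (_∸ a) t) divides-R)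
  d∣diffs : All (gcdL (R (a ∷ t)) ∣_) (map (_∸ a) t)
  d∣diffs = proj₂ (ins-All⁻ a (map (_∸ a) t) divides-R)

map∸-below : ∀ {a x t} → All (a <_) t → All (_< x) t → All (_< x ∸ a) (map (_∸ a) t)
map∸-below []         []         = []
map∸-below (a<z ∷ gs) (z<x ∷ hs) = ∸-monoˡ-< z<x (<⇒≤ a<z) ∷ map∸-below gs hs

R-snoc-below : ∀ a t x → a < x ∸ a → R (a ∷ t ++ x ∷ []) ≡ R (a ∷ t) ++ x ∸ a ∷ []
R-snoc-below a t x a<y =
  trans (R-snoc a t x)
    (trans (ins-snoc-below a (x ∸ a) (map (_∸ a) t) a<y) (cong (_++ _) (sym (R-cons a t))))

R-snoc-absorb : ∀ {a t x} → IsOFS (a ∷ t) → lastL (a ∷ t) < x → a ≡ x ∸ a →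
                R (a ∷ t ++ x ∷ []) ≡ R (a ∷ t)
R-snoc-absorb {a} {t} {x} (_ , _ , L) lt a≡y = begin
  R (a ∷ t ++ x ∷ [])                 ≡⟨ R-snoc a t x ⟩
  ins a (map (_∸ a) t ++ x ∸ a ∷ [])  ≡⟨ cong (λ y → ins a (map (_∸ a) t ++ y ∷ [])) (sym a≡y) ⟩
  ins a (map (_∸ a) t ++ a ∷ [])      ≡⟨ ins-snoc-absorb a (map (_∸ a) t) diffs<a ⟩
  ins a (map (_∸ a) t)                ≡⟨ sym (R-cons a t) ⟩
  R (a ∷ t)                           ∎
  where
  open ≡-Reasoning
  diffs<a : All (_< a) (map (_∸ a) t)
  diffs<a = subst (λ y → All (_< y) (map (_∸ a) t)) (sym a≡y)
              (map∸-below (above-head L) (All.tail (below-bound L lt)))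

f-append-bounded : ∀ n {q x} → x ≤ n → IsOFS q → lastL q < x → gcdL q ∣ x → f q ≤ x →
                   f (q ++ x ∷ []) ≡ x
f-append-bounded zero    x≤0 _ lt _ _ = ⊥-elim (<⇒≱ lt (≤-trans x≤0 z≤n))
f-append-bounded (suc n) {a ∷ t} {x} x≤n O@(_ , (0<a ∷ _) , L) lt g∣x fq≤x = begin
  f (a ∷ t ++ x ∷ [])          ≡⟨ f-unfold (OFS-snoc O lt) (snoc-nonempty t x) ⟩
  a + f (R (a ∷ t ++ x ∷ []))  ≡⟨ cong (a +_) f-R-extended ⟩
  a + (x ∸ a)                  ≡⟨ m+[n∸m]≡n a≤x ⟩
  x                            ∎
  where
  open ≡-Reasoning
  a≤x : a ≤ x
  a≤x = <⇒≤ (≤-<-trans (head≤lastL L) lt)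
  fR≤y : f (R (a ∷ t)) ≤ x ∸ a
  fR≤y = f-R≤ O lt g∣x fq≤x
  f-R-extended : f (R (a ∷ t ++ x ∷ [])) ≡ x ∸ a
  f-R-extended with m≤n⇒m<n∨m≡n (≤-trans (head≤f-R O) fR≤y)
  ... | inj₁ a<y = trans (cong f (R-snoc-below a t x a<y))
                     (f-append-bounded n y≤n (OFS-R O) lastR<y (gcd-R∣ O a≤x g∣x) fR≤y)
    where
    y≤n : x ∸ a ≤ n
    y≤n = ≤-pred (≤-trans (∸-monoʳ-< 0<a a≤x) x≤n)
    lastR<y : lastL (R (a ∷ t)) < x ∸ a
    lastR<y rewrite lastL-R O = ⊔-lub a<y (∸-monoˡ-< lt (head≤lastL L))
  ... | inj₂ a≡y = trans (cong f (R-snoc-absorb O lt a≡y))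
                     (≤-antisym fR≤y (subst (_≤ f (R (a ∷ t))) a≡y (head≤f-R O)))

f-append : ∀ {q x} → IsOFS q → lastL q < x → gcdL q ∣ x → f q ≤ x → f (q ++ x ∷ []) ≡ x
f-append = f-append-bounded _ ≤-refl

take-snoc : ∀ j p → suc j ≤ length p → take (suc j) p ≡ take j p ++ entry p (suc j) ∷ []
take-snoc zero    (x ∷ xs) _       = refl
take-snoc (suc j) (x ∷ xs) (s≤s h) = cong (x ∷_) (take-snoc j xs h)

lastL-take : ∀ j p → 1 ≤ j → j ≤ length p → lastL (take j p) ≡ entry p j
lastL-take (suc zero)    (x ∷ xs)     _ _       = refl
lastL-take (suc (suc j)) (x ∷ y ∷ ys) _ (s≤s h) = lastL-take (suc j) (y ∷ ys) (s≤s z≤n) h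

entry-increasing : ∀ j {p} → Linked _<_ p → 1 ≤ j → suc j ≤ length p → entry p j < entry p (suc j)
entry-increasing (suc zero)    [-]       _ (s≤s ())
entry-increasing (suc zero)    (x<y ∷ _) _ _       = x<y
entry-increasing (suc (suc j)) (_ ∷ L)   _ (s≤s h) = entry-increasing (suc j) L (s≤s z≤n) h

linked-take : ∀ j {l} → Linked _<_ l → Linked _<_ (take j l)
linked-take zero          _         = []
linked-take (suc _)       []        = []
linked-take (suc zero)    {_ ∷ _} _ = [-]
linked-take (suc (suc _)) [-]       = [-]
linked-take (suc (suc j)) (x<y ∷ L) = x<y ∷ linked-take (suc j) L

OFS-take : ∀ j {p} → 1 ≤ j → IsOFS p → IsOFS (take j p)
OFS-take (suc j) {_ ∷ _} _ (_ , P , L) = nonempty , take⁺ (suc j) P , linked-take (suc j) L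

f-prefix-step : ∀ j {p} → IsOFS p → 1 ≤ j → suc j ≤ length p → gcdL p ≡ gcdL (take j p) →
                f (take j p) ≤ entry p (suc j) → f (take (suc j) p) ≡ entry p (suc j)
f-prefix-step j {p} O@(_ , _ , L) 1≤j j<n gcd≡ f≤next rewrite take-snoc j p j<n =
  f-append (OFS-take j 1≤j O) last<next gcd∣next f≤next
  where
  last<next : lastL (take j p) < entry p (suc j)
  last<next = subst (_< entry p (suc j)) (sym (lastL-take j p 1≤j (<⇒≤ j<n)))
                (entry-increasing j L 1≤j j<n)
  gcd∣next : gcdL (take j p) ∣ entry p (suc j)
  gcd∣next = subst (_∣ entry p (suc j)) gcd≡ (All-entry (_ ∣0) (gcdL-divides p) (suc j))

-- Part (ii): once f(p|ᵢ) ≤ p_{i+1}, every later prefix satisfies f(p|ⱼ) = pⱼ,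
-- which in turn gives f(p|ⱼ) < p_{j+1} for the next step.
f-prefix-chain : ∀ i {p} → IsOFS p → 1 ≤ i →
                 (∀ j → i ≤ j → j < length p → gcdL p ≡ gcdL (take j p)) →
                 f (take i p) ≤ entry p (suc i) →
                 ∀ j → suc i ≤ j → j ≤ length p → f (take j p) ≡ entry p j
f-prefix-chain i O 1≤i gcds start zero () _
f-prefix-chain i {p} O@(_ , _ , L) 1≤i gcds start (suc j) (s≤s i≤j) j<n
  with m≤n⇒m<n∨m≡n i≤j
... | inj₂ refl = f-prefix-step i O 1≤i j<n (gcds i ≤-refl j<n) start
... | inj₁ i<j  = f-prefix-step j O (≤-trans 1≤i i≤j) j<n (gcds j i≤j j<n) f≤next
  where
  previous : f (take j p) ≡ entry p j
  previous = f-prefix-chain i O 1≤i gcds start j i<j (<⇒≤ j<n)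
  f≤next : f (take j p) ≤ entry p (suc j)
  f≤next = <⇒≤ (subst (_< entry p (suc j)) (sym previous)
                  (entry-increasing j L (≤-trans 1≤i i≤j) j<n))

-- Part (i): every accepted step of fw passes to a prefix q with f q ≤ max p ≤ f p.
fwFuel≤f : ∀ k {p} → IsOFS p → fwFuel k p ≤ f p
fwFuel≤f zero    O = ≤-refl
fwFuel≤f (suc k) {p} O
  with 2 ≤ᵇ length p in long
     | gcdL (take (length p ∸ 1) p) ≡ᵇ gcdL p
     | f (take (length p ∸ 1) p) ≤ᵇ lastL p in below
... | false | _     | _     = ≤-refl
... | true  | false | _     = ≤-refl
... | true  | true  | false = ≤-refl
... | true  | true  | true  =
  ≤-trans (fwFuel≤f k (OFS-take (length p ∸ 1) 1≤n∸1 O))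
          (≤-trans (≤ᵇ⇒≤ _ _ (subst T (sym below) tt)) (lastL≤f O))
  where
  1≤n∸1 : 1 ≤ length p ∸ 1
  1≤n∸1 = ∸-monoˡ-≤ 1 (≤ᵇ⇒≤ 2 (length p) (subst T (sym long) tt))

proposition10 : (p : List ℕ) → IsOFS p →
    (fw p ≤ f p)
    × ((i : ℕ) → 2 ≤ length p → 1 ≤ i → i < length p →
       ((j : ℕ) → i ≤ j → j < length p → gcdL p ≡ gcdL (prefix p j)) →
       f (prefix p i) ≤ entry p (i + 1) →
       (j : ℕ) → i + 1 ≤ j → j ≤ length p → f (prefix p j) ≡ entry p j)
proposition10 p O =
  fwFuel≤f (length p) O ,
  λ i _ 1≤i _ gcds start j i+1≤j →
    f-prefix-chain i O 1≤i gcds (subst (λ k → f (take i p) ≤ entry p k) i+1≡suc start)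
      j (subst (_≤ j) i+1≡suc i+1≤j)
  where
  i+1≡suc : ∀ {i} → i + 1 ≡ suc i
  i+1≡suc {i} = +-comm i 1
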